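{- For $n\ge1$ let $V_n:=\sum_{w\in\mathcal F_{n,2}}\mathrm{ver}(G(w))$ and $D^{(4)}_n:=\sum_{w\in\mathcal F_{n,2}}\deg_4(G(w))$. Then $$\lim_{n\to\infty}\frac{D^{(4)}_n}{V_n}=\frac{7-\sqrt5}{22}.$$
   Context: $\mathcal F_{n,2}$ is the set of binary words $w=w_1\cdots w_n$ with no two consecutive $1$'s. $P(w)$ is the bargraph polyomino formed by the unit squares $[i-1,i]\times[j-1,j]$, $1\le i\le n$, $1\le j\le w_i+1$. $G(w)$ is the graph whose vertices are the corners of the cells of $P(w)$ and whose edges are the cell sides. $\mathrm{ver}(G)$ is the number of vertices of $G$ and $\deg_4(G)$ the number of vertices of degree $4$. -}

module Defs where

open import Data.Bool using (Bool; true; false; _∧_; _∨_; not; if_then_else_)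
open import Data.Nat as ℕ using (ℕ; zero; suc; _≤ᵇ_; _<ᵇ_)
open import Data.List using (List; []; _∷_; map; concatMap; filterᵇ; upTo)
open import Data.Nat.ListAction using (sum)
open import Data.Vec using (Vec; []; _∷_)
open import Data.Integer using (+_)
open import Data.Rational using (ℚ; _/_; 0ℚ; _<_; _+_; _-_; _*_)
open import Data.Sum using (_⊎_)
open import Data.Product using (_×_; ∃-syntax)

-- all binary words of length n (true = letter 1, false = letter 0)
words : (n : ℕ) → List (Vec Bool n)
words zero = [] ∷ []
words (suc n) = concatMap (λ w → (false ∷ w) ∷ (true ∷ w) ∷ []) (words n)

noOneOne : ∀ {n} → Vec Bool n → Bool
noOneOne [] = true
noOneOne (_ ∷ []) = true
noOneOne (a ∷ b ∷ w) = not (a ∧ b) ∧ noOneOne (b ∷ w)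

F2 : (n : ℕ) → List (Vec Bool n)
F2 n = filterᵇ noOneOne (words n)

-- Bargraph P(w): cell [i-1,i]×[j-1,j] present iff 1 ≤ i ≤ n, 1 ≤ j ≤ w_i + 1

bit : Bool → ℕ
bit true = 1
bit false = 0

-- letter w_{i+1} (0-based index i); the index is always < n where used
letter : ∀ {n} → Vec Bool n → ℕ → ℕ
letter [] _ = 0
letter (a ∷ w) zero = bit a
letter (a ∷ w) (suc i) = letter w i

cell : ∀ {n} → Vec Bool n → ℕ → ℕ → Bool
cell w zero _ = false
cell w (suc i) zero = false
cell {n} w (suc i) (suc j) = (i <ᵇ n) ∧ (j ≤ᵇ letter w i)

-- Graph G(w): vertices = corners of cells, edges = cell sides

isVertex : ∀ {n} → Vec Bool n → ℕ → ℕ → Bool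
isVertex w x y = cell w x y ∨ cell w (suc x) y ∨ cell w x (suc y) ∨ cell w (suc x) (suc y)

-- horizontal unit segment (x,y)–(x+1,y) is a side (bottom or top) of a cell
hEdge : ∀ {n} → Vec Bool n → ℕ → ℕ → Bool
hEdge w x y = cell w (suc x) (suc y) ∨ cell w (suc x) y

-- vertical unit segment (x,y)–(x,y+1) is a side (left or right) of a cell
vEdge : ∀ {n} → Vec Bool n → ℕ → ℕ → Bool
vEdge w x y = cell w (suc x) (suc y) ∨ cell w x (suc y)

degree : ∀ {n} → Vec Bool n → ℕ → ℕ → ℕ
degree w x y = bit (hEdge w x y) ℕ.+ left x ℕ.+ bit (vEdge w x y) ℕ.+ down y
  where
  left : ℕ → ℕ
  left zero = 0
  left (suc x') = bit (hEdge w x' y)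
  down : ℕ → ℕ
  down zero = 0
  down (suc y') = bit (vEdge w x y')

-- all lattice points that can possibly be corners: 0 ≤ x ≤ n, 0 ≤ y ≤ 3
-- (cells have height at most 2, so every corner has y ≤ 2)
points : ℕ → List (ℕ × ℕ)
points n = concatMap (λ x → map (λ y → x Data.Product., y) (upTo 4)) (upTo (suc n))

countPts : ∀ {n} → (Vec Bool n → ℕ → ℕ → Bool) → Vec Bool n → ℕ
countPts {n} p w = sum (map (λ xy → bit (p w (Data.Product.proj₁ xy) (Data.Product.proj₂ xy))) (points n))

ver : ∀ {n} → Vec Bool n → ℕ
ver = countPts isVertex

deg4 : ∀ {n} → Vec Bool n → ℕ
deg4 = countPts (λ w x y → isVertex w x y ∧ (degree w x y ℕ.≡ᵇ 4))

V : ℕ → ℕ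
V n = sum (map ver (F2 n))

D4 : ℕ → ℕ
D4 n = sum (map deg4 (F2 n))

-- the rational a / b (b = 0 gives 0; V n > 0 for all n ≥ 1 anyway)
frac : ℕ → ℕ → ℚ
frac a zero = 0ℚ
frac a (suc b) = + a / suc b

-- The real number L = (7 - √5)/22 given by its Dedekind cut on ℚ,
-- and convergence of a rational sequence to it.

nat : ℕ → ℚ
nat k = + k / 1

ltSqrt5 : ℚ → Set
ltSqrt5 q = (q < 0ℚ) ⊎ (q * q < nat 5)

sqrt5Lt : ℚ → Set
sqrt5Lt q = (0ℚ < q) × (nat 5 < q * q)

-- q < (7 - √5)/22  iff  √5 < 7 - 22 q
ltL : ℚ → Set
ltL q = sqrt5Lt (nat 7 - nat 22 * q)

-- (7 - √5)/22 < q  iff  7 - 22 q < √5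
Lgt : ℚ → Set
Lgt q = ltSqrt5 (nat 7 - nat 22 * q)

-- lim_{n→∞} a n = (7 - √5)/22 :  ∀ ε > 0, ∃ N, ∀ n ≥ N, |a n - L| < ε
ConvergesToL : (ℕ → ℚ) → Set
ConvergesToL a = ∀ (ε : ℚ) → 0ℚ < ε → ∃[ N ] (∀ n → N ℕ.≤ n → ltL (a n - ε) × Lgt (a n + ε))

module Submission where

open import Defs

-- Prepending a letter to a word shifts its bargraph one column to the right and
-- changes only the first two columns, so ver and deg₄ grow by a constant that
-- depends on the first two letters.  Summing over F_{n,2} split by the first
-- letter gives linear recurrences, solved by 5 V_n = n(12a + 14b) + 10a + 14b and
-- 5 D_n + 6b = n(2a + 4b), where a = F_{n+1} and b = F_n count the words starting
-- with 0 and with 1.  With v = 5 V_n and p = 7v - 22 · 5 D_n, Cassini's identity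
-- a² - ab - b² = ±1 gives 0 ≤ p² - 5v² = O(v²/n), so p/v → √5 and hence
-- D_n/V_n = (7 - p/v)/22 → (7 - √5)/22.  All estimates are done in ℕ after
-- clearing the denominator of ε.

module ListSums where

  open import Data.Bool using (Bool; true; false; if_then_else_)
  open import Data.Nat using (ℕ; zero; suc; _+_; _*_)
  open import Data.Nat.Properties using (*-zeroʳ; *-distribˡ-+; +-commutativeSemigroup)
  open import Algebra.Properties.CommutativeSemigroup +-commutativeSemigroup using (interchange)
  open import Data.List using (List; []; _∷_; _++_; map; concatMap; filterᵇ; applyUpTo)
  open import Data.List.Properties using (map-++)
  open import Data.Nat.ListAction using (sum)
  open import Data.Nat.ListAction.Properties using (sum-++)
  open import Function using (_∘_)
  open import Relation.Binary.PropositionalEquality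
  open ≡-Reasoning

  module _ {A : Set} where

    sum-map-+ : ∀ (f g : A → ℕ) xs → sum (map (λ x → f x + g x) xs) ≡ sum (map f xs) + sum (map g xs)
    sum-map-+ f g []       = refl
    sum-map-+ f g (x ∷ xs) = begin
      f x + g x + sum (map (λ x → f x + g x) xs) ≡⟨ cong (f x + g x +_) (sum-map-+ f g xs) ⟩
      f x + g x + (sum (map f xs) + sum (map g xs)) ≡⟨ interchange (f x) (g x) _ _ ⟩
      (f x + sum (map f xs)) + (g x + sum (map g xs)) ∎

    sum-map-* : ∀ k (f : A → ℕ) xs → sum (map (λ x → k * f x) xs) ≡ k * sum (map f xs)
    sum-map-* k f []       = sym (*-zeroʳ k)
    sum-map-* k f (x ∷ xs) =
      trans (cong (k * f x +_) (sum-map-* k f xs)) (sym (*-distribˡ-+ k (f x) _))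

    sum-map-filterᵇ : ∀ (P : A → Bool) (f : A → ℕ) xs →
      sum (map f (filterᵇ P xs)) ≡ sum (map (λ x → if P x then f x else 0) xs)
    sum-map-filterᵇ P f []       = refl
    sum-map-filterᵇ P f (x ∷ xs) with P x
    ... | true  = cong (f x +_) (sum-map-filterᵇ P f xs)
    ... | false = sum-map-filterᵇ P f xs

    sum-map-concatMap : ∀ {B : Set} (f : B → ℕ) (g : A → List B) xs →
      sum (map f (concatMap g xs)) ≡ sum (map (λ x → sum (map f (g x))) xs)
    sum-map-concatMap f g []       = refl
    sum-map-concatMap f g (x ∷ xs) = begin
      sum (map f (g x ++ concatMap g xs))              ≡⟨ cong sum (map-++ f (g x) _) ⟩
      sum (map f (g x) ++ map f (concatMap g xs))      ≡⟨ sum-++ (map f (g x)) _ ⟩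
      sum (map f (g x)) + sum (map f (concatMap g xs)) ≡⟨ cong (_ +_) (sum-map-concatMap f g xs) ⟩
      sum (map f (g x)) + sum (map (λ x → sum (map f (g x))) xs) ∎

  sum-map-applyUpTo-cong : ∀ {f f′ g g′ : ℕ → ℕ} → (∀ x → f (g x) ≡ f′ (g′ x)) →
    ∀ k → sum (map f (applyUpTo g k)) ≡ sum (map f′ (applyUpTo g′ k))
  sum-map-applyUpTo-cong eq zero    = refl
  sum-map-applyUpTo-cong eq (suc k) = cong₂ _+_ (eq 0) (sum-map-applyUpTo-cong (eq ∘ suc) k)

module Columns where

  open ListSums
  open import Data.Bool using (Bool; true; false; _∧_)
  open import Data.Nat using (ℕ; suc; _+_; _≡ᵇ_)
  open import Data.Nat.Properties using (+-assoc; +-commutativeSemigroup)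
  open import Algebra.Properties.CommutativeSemigroup +-commutativeSemigroup using (xy∙z≈xz∙y)
  open import Data.List using (map; upTo; applyUpTo)
  open import Data.Nat.ListAction using (sum)
  open import Data.Vec using (Vec; _∷_)
  open import Data.Product using (_,_; proj₁; proj₂)
  open import Function using (_∘_)
  open import Relation.Binary.PropositionalEquality
  open ≡-Reasoning

  PointPredicate : Set
  PointPredicate = ∀ {n} → Vec Bool n → ℕ → ℕ → Bool

  column : ∀ {n} → PointPredicate → Vec Bool n → ℕ → ℕ
  column P w x = sum (map (λ y → bit (P w x y)) (upTo 4))

  countPts-columns : ∀ {n} (P : PointPredicate) (w : Vec Bool n) → countPts P w ≡ sum (map (column P w) (upTo (suc n)))
  countPts-columns {n} P w =
    sum-map-concatMap (λ xy → bit (P w (proj₁ xy) (proj₂ xy))) (λ x → map (x ,_) (upTo 4)) (upTo (suc n))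

  -- For properties that only inspect neighbouring cells the shift hypothesis
  -- holds by computation.
  countPts-∷∷ : ∀ {n} (P : PointPredicate) b c (w : Vec Bool n) k →
    (∀ x → column P (b ∷ c ∷ w) (suc (suc x)) ≡ column P (c ∷ w) (suc x)) →
    column P (b ∷ c ∷ w) 0 + column P (b ∷ c ∷ w) 1 ≡ column P (c ∷ w) 0 + k →
    countPts P (b ∷ c ∷ w) ≡ countPts P (c ∷ w) + k
  countPts-∷∷ {n} P b c w k shift head = begin
    countPts P (b ∷ c ∷ w)                   ≡⟨ countPts-columns P (b ∷ c ∷ w) ⟩
    C₀ + (C₁ + rest)                         ≡⟨ +-assoc C₀ C₁ rest ⟨
    C₀ + C₁ + rest                           ≡⟨ cong (_+ rest) head ⟩
    c₀ + k + rest                            ≡⟨ xy∙z≈xz∙y c₀ k rest ⟩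
    c₀ + rest + k                            ≡⟨ cong (λ s → c₀ + s + k) (sum-map-applyUpTo-cong shift (suc n)) ⟩
    c₀ + sum (map (column P (c ∷ w)) (applyUpTo suc (suc n))) + k
                                             ≡⟨ cong (_+ k) (countPts-columns P (c ∷ w)) ⟨
    countPts P (c ∷ w) + k                   ∎
    where
    C₀ = column P (b ∷ c ∷ w) 0
    C₁ = column P (b ∷ c ∷ w) 1
    c₀ = column P (c ∷ w) 0
    rest = sum (map (column P (b ∷ c ∷ w)) (applyUpTo (suc ∘ suc) (suc n)))

  hasDegree4 : PointPredicate
  hasDegree4 w x y = isVertex w x y ∧ (degree w x y ≡ᵇ 4)

  ver-0∷ : ∀ {n} c (w : Vec Bool n) → ver (false ∷ c ∷ w) ≡ ver (c ∷ w) + 2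
  ver-0∷ false w = countPts-∷∷ isVertex false false w 2 (λ _ → refl) refl
  ver-0∷ true  w = countPts-∷∷ isVertex false true  w 2 (λ _ → refl) refl

  ver-10 : ∀ {n} (w : Vec Bool n) → ver (true ∷ false ∷ w) ≡ ver (false ∷ w) + 4
  ver-10 w = countPts-∷∷ isVertex true false w 4 (λ _ → refl) refl

  deg4-0∷ : ∀ {n} c (w : Vec Bool n) → deg4 (false ∷ c ∷ w) ≡ deg4 (c ∷ w) + bit c
  deg4-0∷ false w = countPts-∷∷ hasDegree4 false false w 0 (λ _ → refl) refl
  deg4-0∷ true  w = countPts-∷∷ hasDegree4 false true  w 1 (λ _ → refl) refl

  deg4-10 : ∀ {n} (w : Vec Bool n) → deg4 (true ∷ false ∷ w) ≡ deg4 (false ∷ w) + 1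
  deg4-10 w = countPts-∷∷ hasDegree4 true false w 1 (λ _ → refl) refl

module FirstLetterSums where

  open ListSums
  open Columns
  open import Data.Bool using (Bool; true; false; if_then_else_)
  open import Data.Nat using (ℕ; suc; _+_; _*_)
  open import Data.Nat.Properties using (+-identityʳ; *-zeroʳ; *-identityʳ; +-commutativeSemigroup)
  open import Algebra.Properties.CommutativeSemigroup +-commutativeSemigroup using (interchange)
  open import Data.List using ([]; _∷_; map)
  open import Data.List.Properties using (map-cong)
  open import Data.Nat.ListAction using (sum)
  open import Data.Vec using (Vec; _∷_)
  open import Relation.Binary.PropositionalEquality
  open ≡-Reasoning

  WordStatistic : Set
  WordStatistic = ∀ {n} → Vec Bool n → ℕ

  sum-words-suc : ∀ n (f : Vec Bool (suc n) → ℕ) →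
    sum (map f (words (suc n))) ≡ sum (map (λ w → f (false ∷ w) + f (true ∷ w)) (words n))
  sum-words-suc n f = trans (sum-map-concatMap f (λ w → (false ∷ w) ∷ (true ∷ w) ∷ []) (words n))
                            (cong sum (map-cong (λ w → cong (f (false ∷ w) +_) (+-identityʳ _)) (words n)))

  restrict : Bool → ℕ → ℕ
  restrict b x = if b then x else 0

  startSum : Bool → ℕ → WordStatistic → ℕ
  startSum b m f = sum (map (λ w → restrict (noOneOne (b ∷ w)) (f (b ∷ w))) (words m))

  startCount : Bool → ℕ → ℕ
  startCount b m = startSum b m (λ _ → 1)

  sum-F2 : ∀ m (f : WordStatistic) → sum (map f (F2 (suc m))) ≡ startSum false m f + startSum true m f
  sum-F2 m f = begin
    sum (map f (F2 (suc m)))                                           ≡⟨ sum-map-filterᵇ noOneOne f (words (suc m)) ⟩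
    sum (map (λ w → restrict (noOneOne w) (f w)) (words (suc m)))      ≡⟨ sum-words-suc m _ ⟩
    sum (map (λ w → restrict (noOneOne (false ∷ w)) (f (false ∷ w))
                  + restrict (noOneOne (true ∷ w)) (f (true ∷ w))) (words m)) ≡⟨ sum-map-+ _ _ (words m) ⟩
    startSum false m f + startSum true m f ∎

  restrict-+ : ∀ b x y → restrict b (x + y) ≡ restrict b x + y * restrict b 1
  restrict-+ true  x y = cong (x +_) (sym (*-identityʳ y))
  restrict-+ false x y = sym (*-zeroʳ y)

  module _ (f : WordStatistic) (δ : Bool → ℕ) (δ₁₀ : ℕ)
           (f-0∷ : ∀ {n} c (w : Vec Bool n) → f (false ∷ c ∷ w) ≡ f (c ∷ w) + δ c)
           (f-10 : ∀ {n} (w : Vec Bool n) → f (true ∷ false ∷ w) ≡ f (false ∷ w) + δ₁₀) where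

    startSum-0-suc : ∀ m → startSum false (suc m) f
      ≡ (startSum false m f + startSum true m f) + (δ false * startCount false m + δ true * startCount true m)
    startSum-0-suc m = begin
      startSum false (suc m) f ≡⟨ sum-words-suc m _ ⟩
      sum (map (λ w → restrict (noOneOne (false ∷ w)) (f (false ∷ false ∷ w))
                    + restrict (noOneOne (true ∷ w)) (f (false ∷ true ∷ w))) (words m))
        ≡⟨ cong sum (map-cong (λ w → cong₂ _+_ (step false w) (step true w)) (words m)) ⟩
      sum (map (λ w → (A false w + δ false * B false w) + (A true w + δ true * B true w)) (words m))
        ≡⟨ cong sum (map-cong (λ w → interchange (A false w) _ (A true w) _) (words m)) ⟩
      sum (map (λ w → (A false w + A true w) + (δ false * B false w + δ true * B true w)) (words m))
        ≡⟨ sum-map-+ (λ w → A false w + A true w) (λ w → δ false * B false w + δ true * B true w) (words m) ⟩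
      sum (map (λ w → A false w + A true w) (words m))
        + sum (map (λ w → δ false * B false w + δ true * B true w) (words m))
        ≡⟨ cong₂ _+_ (sum-map-+ (A false) (A true) (words m))
                     (trans (sum-map-+ (λ w → δ false * B false w) (λ w → δ true * B true w) (words m))
                            (cong₂ _+_ (sum-map-* (δ false) (B false) (words m)) (sum-map-* (δ true) (B true) (words m)))) ⟩
      (startSum false m f + startSum true m f) + (δ false * startCount false m + δ true * startCount true m) ∎
      where
      A B : Bool → ∀ {n} → Vec Bool n → ℕ
      A c w = restrict (noOneOne (c ∷ w)) (f (c ∷ w))
      B c w = restrict (noOneOne (c ∷ w)) 1
      step : ∀ {n} c (w : Vec Bool n) → restrict (noOneOne (c ∷ w)) (f (false ∷ c ∷ w)) ≡ A c w + δ c * B c w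
      step c w = trans (cong (restrict (noOneOne (c ∷ w))) (f-0∷ c w)) (restrict-+ _ _ (δ c))

    startSum-1-suc : ∀ m → startSum true (suc m) f ≡ startSum false m f + δ₁₀ * startCount false m
    startSum-1-suc m = begin
      startSum true (suc m) f ≡⟨ sum-words-suc m _ ⟩
      sum (map (λ w → restrict (noOneOne (false ∷ w)) (f (true ∷ false ∷ w)) + 0) (words m))
        ≡⟨ cong sum (map-cong step (words m)) ⟩
      sum (map (λ w → A w + δ₁₀ * B w) (words m))
        ≡⟨ trans (sum-map-+ A (λ w → δ₁₀ * B w) (words m)) (cong (startSum false m f +_) (sum-map-* δ₁₀ B (words m))) ⟩
      startSum false m f + δ₁₀ * startCount false m ∎
      where
      A B : ∀ {n} → Vec Bool n → ℕ
      A w = restrict (noOneOne (false ∷ w)) (f (false ∷ w))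
      B w = restrict (noOneOne (false ∷ w)) 1
      step : ∀ {n} (w : Vec Bool n) → restrict (noOneOne (false ∷ w)) (f (true ∷ false ∷ w)) + 0 ≡ A w + δ₁₀ * B w
      step w = trans (+-identityʳ _) (trans (cong (restrict (noOneOne (false ∷ w))) (f-10 w)) (restrict-+ _ _ δ₁₀))

  startCount-0-suc : ∀ m → startCount false (suc m) ≡ startCount false m + startCount true m
  startCount-0-suc m = trans (startSum-0-suc (λ _ → 1) (λ _ → 0) 0 (λ _ _ → refl) (λ _ → refl) m) (+-identityʳ _)

  startCount-1-suc : ∀ m → startCount true (suc m) ≡ startCount false m
  startCount-1-suc m = trans (startSum-1-suc (λ _ → 1) (λ _ → 0) 0 (λ _ _ → refl) (λ _ → refl) m) (+-identityʳ _)

module ClosedForms where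

  open Columns
  open FirstLetterSums
  open import Data.Bool using (true; false)
  open import Data.Nat using (ℕ; zero; suc; _+_; _*_; _≤_; s≤s; z≤n)
  open import Data.Nat.Properties using (+-cancelʳ-≡; +-mono-≤; +-comm; ≤-trans)
  open import Data.List using ([]; _∷_)
  open import Data.Sum using (_⊎_; inj₁; inj₂)
  open import Relation.Binary.PropositionalEquality
  open import Data.Nat.Tactic.RingSolver using (solve)
  open ≡-Reasoning

  -- Closed forms of the first-letter sums, with both sides moved so that no
  -- subtraction occurs.
  record VerClosedForm (n a b o₀ o₁ : ℕ) : Set where
    field
      start₀ : 5 * o₀ + 2 * n * b + 2 * b ≡ 14 * n * a + 10 * a
      start₁ : 5 * o₁ + 2 * n * a ≡ 16 * n * b + 16 * b

  record Deg4ClosedForm (n a b d₀ d₁ : ℕ) : Set where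
    field
      start₀ : 5 * d₀ + 2 * n * b + 5 * a ≡ 4 * n * a + 3 * b
      start₁ : 5 * d₁ + 2 * n * a + 9 * b ≡ 6 * n * b + 5 * a

  verClosedForm-step : ∀ {n a b o₀ o₁} → VerClosedForm n a b o₀ o₁ →
    VerClosedForm (suc n) (a + b) a ((o₀ + o₁) + (2 * a + 2 * b)) (o₀ + 4 * a)
  verClosedForm-step {n} {a} {b} {o₀} {o₁} cf = record
    { start₀ = +-cancelʳ-≡ (2 * n * b + 2 * b + 2 * n * a) _ _ (begin
        5 * ((o₀ + o₁) + (2 * a + 2 * b)) + 2 * suc n * a + 2 * a + (2 * n * b + 2 * b + 2 * n * a)
          ≡⟨ solve (o₀ ∷ o₁ ∷ a ∷ b ∷ n ∷ []) ⟩
        (5 * o₀ + 2 * n * b + 2 * b) + (5 * o₁ + 2 * n * a) + (12 * a + 10 * b + 2 * suc n * a)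
          ≡⟨ cong₂ (λ u v → u + v + (12 * a + 10 * b + 2 * suc n * a)) start₀ start₁ ⟩
        (14 * n * a + 10 * a) + (16 * n * b + 16 * b) + (12 * a + 10 * b + 2 * suc n * a)
          ≡⟨ solve (a ∷ b ∷ n ∷ []) ⟩
        14 * suc n * (a + b) + 10 * (a + b) + (2 * n * b + 2 * b + 2 * n * a) ∎)
    ; start₁ = +-cancelʳ-≡ (2 * n * b + 2 * b) _ _ (begin
        5 * (o₀ + 4 * a) + 2 * suc n * (a + b) + (2 * n * b + 2 * b)
          ≡⟨ solve (o₀ ∷ a ∷ b ∷ n ∷ []) ⟩
        (5 * o₀ + 2 * n * b + 2 * b) + (20 * a + 2 * suc n * (a + b))
          ≡⟨ cong (_+ (20 * a + 2 * suc n * (a + b))) start₀ ⟩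
        (14 * n * a + 10 * a) + (20 * a + 2 * suc n * (a + b))
          ≡⟨ solve (a ∷ b ∷ n ∷ []) ⟩
        16 * suc n * a + 16 * a + (2 * n * b + 2 * b) ∎)
    }
    where open VerClosedForm cf

  deg4ClosedForm-step : ∀ {n a b d₀ d₁} → Deg4ClosedForm n a b d₀ d₁ →
    Deg4ClosedForm (suc n) (a + b) a ((d₀ + d₁) + (0 * a + 1 * b)) (d₀ + 1 * a)
  deg4ClosedForm-step {n} {a} {b} {d₀} {d₁} cf = record
    { start₀ = +-cancelʳ-≡ (2 * n * b + 5 * a + 2 * n * a + 9 * b) _ _ (begin
        5 * ((d₀ + d₁) + (0 * a + 1 * b)) + 2 * suc n * a + 5 * (a + b) + (2 * n * b + 5 * a + 2 * n * a + 9 * b)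
          ≡⟨ solve (d₀ ∷ d₁ ∷ a ∷ b ∷ n ∷ []) ⟩
        (5 * d₀ + 2 * n * b + 5 * a) + (5 * d₁ + 2 * n * a + 9 * b) + (10 * b + 2 * suc n * a + 5 * a)
          ≡⟨ cong₂ (λ u v → u + v + (10 * b + 2 * suc n * a + 5 * a)) start₀ start₁ ⟩
        (4 * n * a + 3 * b) + (6 * n * b + 5 * a) + (10 * b + 2 * suc n * a + 5 * a)
          ≡⟨ solve (a ∷ b ∷ n ∷ []) ⟩
        4 * suc n * (a + b) + 3 * a + (2 * n * b + 5 * a + 2 * n * a + 9 * b) ∎)
    ; start₁ = +-cancelʳ-≡ (2 * n * b + 5 * a) _ _ (begin
        5 * (d₀ + 1 * a) + 2 * suc n * (a + b) + 9 * a + (2 * n * b + 5 * a)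
          ≡⟨ solve (d₀ ∷ a ∷ b ∷ n ∷ []) ⟩
        (5 * d₀ + 2 * n * b + 5 * a) + (5 * a + 2 * suc n * (a + b) + 9 * a)
          ≡⟨ cong (_+ (5 * a + 2 * suc n * (a + b) + 9 * a)) start₀ ⟩
        (4 * n * a + 3 * b) + (5 * a + 2 * suc n * (a + b) + 9 * a)
          ≡⟨ solve (a ∷ b ∷ n ∷ []) ⟩
        6 * suc n * a + 5 * (a + b) + (2 * n * b + 5 * a) ∎)
    }
    where open Deg4ClosedForm cf

  verClosedForm : ∀ m → VerClosedForm (suc m) (startCount false m) (startCount true m)
                                       (startSum false m ver) (startSum true m ver)
  verClosedForm zero = record { start₀ = refl ; start₁ = refl }
  verClosedForm (suc m)
    rewrite startCount-0-suc m | startCount-1-suc m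
          | startSum-0-suc ver (λ _ → 2) 4 ver-0∷ ver-10 m
          | startSum-1-suc ver (λ _ → 2) 4 ver-0∷ ver-10 m
          = verClosedForm-step (verClosedForm m)

  deg4ClosedForm : ∀ m → Deg4ClosedForm (suc m) (startCount false m) (startCount true m)
                                         (startSum false m deg4) (startSum true m deg4)
  deg4ClosedForm zero = record { start₀ = refl ; start₁ = refl }
  deg4ClosedForm (suc m)
    rewrite startCount-0-suc m | startCount-1-suc m
          | startSum-0-suc deg4 bit 1 deg4-0∷ deg4-10 m
          | startSum-1-suc deg4 bit 1 deg4-0∷ deg4-10 m
          = deg4ClosedForm-step (deg4ClosedForm m)

  verClosedForm-total : ∀ {n a b o₀ o₁} → VerClosedForm n a b o₀ o₁ →
    5 * (o₀ + o₁) ≡ n * (12 * a + 14 * b) + 10 * a + 14 * b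
  verClosedForm-total {n} {a} {b} {o₀} {o₁} cf = +-cancelʳ-≡ (2 * n * b + 2 * b + 2 * n * a) _ _ (begin
    5 * (o₀ + o₁) + (2 * n * b + 2 * b + 2 * n * a)     ≡⟨ solve (n ∷ a ∷ b ∷ o₀ ∷ o₁ ∷ []) ⟩
    (5 * o₀ + 2 * n * b + 2 * b) + (5 * o₁ + 2 * n * a) ≡⟨ cong₂ _+_ start₀ start₁ ⟩
    (14 * n * a + 10 * a) + (16 * n * b + 16 * b)       ≡⟨ solve (n ∷ a ∷ b ∷ []) ⟩
    n * (12 * a + 14 * b) + 10 * a + 14 * b + (2 * n * b + 2 * b + 2 * n * a) ∎)
    where open VerClosedForm cf

  deg4ClosedForm-total : ∀ {n a b d₀ d₁} → Deg4ClosedForm n a b d₀ d₁ →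
    5 * (d₀ + d₁) + 6 * b ≡ n * (2 * a + 4 * b)
  deg4ClosedForm-total {n} {a} {b} {d₀} {d₁} cf = +-cancelʳ-≡ (2 * n * b + 5 * a + 2 * n * a + 3 * b) _ _ (begin
    5 * (d₀ + d₁) + 6 * b + (2 * n * b + 5 * a + 2 * n * a + 3 * b) ≡⟨ solve (n ∷ a ∷ b ∷ d₀ ∷ d₁ ∷ []) ⟩
    (5 * d₀ + 2 * n * b + 5 * a) + (5 * d₁ + 2 * n * a + 9 * b)     ≡⟨ cong₂ _+_ start₀ start₁ ⟩
    (4 * n * a + 3 * b) + (6 * n * b + 5 * a)                       ≡⟨ solve (n ∷ a ∷ b ∷ []) ⟩
    n * (2 * a + 4 * b) + (2 * n * b + 5 * a + 2 * n * a + 3 * b)   ∎)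
    where open Deg4ClosedForm cf

  5*V-closedForm : ∀ m → let a = startCount false m; b = startCount true m in
    5 * V (suc m) ≡ suc m * (12 * a + 14 * b) + 10 * a + 14 * b
  5*V-closedForm m = trans (cong (5 *_) (sum-F2 m ver)) (verClosedForm-total (verClosedForm m))

  5*D4-closedForm : ∀ m → let a = startCount false m; b = startCount true m in
    5 * D4 (suc m) + 6 * b ≡ suc m * (2 * a + 4 * b)
  5*D4-closedForm m =
    trans (cong (λ s → 5 * s + 6 * startCount true m) (sum-F2 m deg4)) (deg4ClosedForm-total (deg4ClosedForm m))

  Cassini : ℕ → ℕ → Set
  Cassini a b = (a * a ≡ a * b + b * b + 1) ⊎ (a * a + 1 ≡ a * b + b * b)

  cassini-step : ∀ {a b} → Cassini a b → Cassini (a + b) a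
  cassini-step {a} {b} (inj₁ eq) = inj₂ (begin
    (a + b) * (a + b) + 1             ≡⟨ solve (a ∷ b ∷ []) ⟩
    (a + b) * a + (a * b + b * b + 1) ≡⟨ cong ((a + b) * a +_) eq ⟨
    (a + b) * a + a * a               ∎)
  cassini-step {a} {b} (inj₂ eq) = inj₁ (begin
    (a + b) * (a + b)                 ≡⟨ solve (a ∷ b ∷ []) ⟩
    (a + b) * a + (a * b + b * b)     ≡⟨ cong ((a + b) * a +_) eq ⟨
    (a + b) * a + (a * a + 1)         ≡⟨ solve (a ∷ b ∷ []) ⟩
    (a + b) * a + a * a + 1           ∎)

  record FibonacciPair (n a b : ℕ) : Set where
    field
      n≤a : n ≤ a
      1≤b : 1 ≤ b
      cassini : Cassini a b

  fibonacciPair-step : ∀ {n a b} → FibonacciPair (suc n) a b → FibonacciPair (suc (suc n)) (a + b) a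
  fibonacciPair-step {n} {a} {b} fp = record
    { n≤a = subst (_≤ a + b) (+-comm (suc n) 1) (+-mono-≤ n≤a 1≤b)
    ; 1≤b = ≤-trans (s≤s (z≤n {n})) n≤a
    ; cassini = cassini-step {a} {b} cassini
    }
    where open FibonacciPair fp

  startCounts-fibonacci : ∀ m → FibonacciPair (suc m) (startCount false m) (startCount true m)
  startCounts-fibonacci zero = record { n≤a = s≤s z≤n ; 1≤b = s≤s z≤n ; cassini = inj₂ refl }
  startCounts-fibonacci (suc m)
    rewrite startCount-0-suc m | startCount-1-suc m = fibonacciPair-step (startCounts-fibonacci m)

module Estimates where

  open ClosedForms using (Cassini)
  open import Data.Nat
  open import Data.Nat.Properties
  open import Data.List using ([]; _∷_)
  open import Data.Product using (_×_; _,_; proj₁; proj₂)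
  open import Data.Sum using (_⊎_; inj₁; inj₂)
  open import Relation.Binary.PropositionalEquality
  open import Relation.Nullary using (yes; no; contradiction)
  open import Data.Nat.Tactic.RingSolver using (solve; solve-∀)

  -- With a, b the numbers of words of F_{n,2} starting with 0 and with 1,
  -- vPoly = 5 V_n and pPoly = 5 (7 V_n - 22 D_n).
  vPoly pPoly remainder : ℕ → ℕ → ℕ → ℕ
  vPoly n a b = n * (12 * a + 14 * b) + 10 * a + 14 * b
  pPoly n a b = n * (40 * a + 10 * b) + 70 * a + 230 * b
  remainder n a b = n * (4400 * (a * a) + 16720 * (a * b) + 2640 * (b * b))
                  + (4400 * (a * a) + 30800 * (a * b) + 51920 * (b * b))

  pPoly+22*d : ∀ n a b d → d + 6 * b ≡ n * (2 * a + 4 * b) → pPoly n a b + 22 * d ≡ 7 * vPoly n a b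
  pPoly+22*d n a b d eq = +-cancelʳ-≡ (132 * b) _ _ (begin
    pPoly n a b + 22 * d + 132 * b                    ≡⟨ regroup (pPoly n a b) d b ⟩
    pPoly n a b + 22 * (d + 6 * b)                    ≡⟨ cong (λ x → pPoly n a b + 22 * x) eq ⟩
    n * (40 * a + 10 * b) + 70 * a + 230 * b + 22 * (n * (2 * a + 4 * b)) ≡⟨ solve (n ∷ a ∷ b ∷ []) ⟩
    7 * (n * (12 * a + 14 * b) + 10 * a + 14 * b) + 132 * b ∎)
    where
    open ≡-Reasoning
    regroup : ∀ p d b → p + 22 * d + 132 * b ≡ p + 22 * (d + 6 * b)
    regroup = solve-∀

  -- p² - 5 v² = 880 n² (a² - ab - b²) + remainder, and a² - ab - b² = ±1.
  pell-identity : ∀ n a b →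
    pPoly n a b * pPoly n a b + 880 * (n * n) * (a * b + b * b)
      ≡ 5 * (vPoly n a b * vPoly n a b) + 880 * (n * n) * (a * a) + remainder n a b
  pell-identity = expanded
    where
    expanded : ∀ n a b →
      (n * (40 * a + 10 * b) + 70 * a + 230 * b) * (n * (40 * a + 10 * b) + 70 * a + 230 * b)
        + 880 * (n * n) * (a * b + b * b)
      ≡ 5 * ((n * (12 * a + 14 * b) + 10 * a + 14 * b) * (n * (12 * a + 14 * b) + 10 * a + 14 * b))
        + 880 * (n * n) * (a * a)
        + (n * (4400 * (a * a) + 16720 * (a * b) + 2640 * (b * b))
           + (4400 * (a * a) + 30800 * (a * b) + 51920 * (b * b)))
    expanded = solve-∀

  squeeze : ∀ {x z c l u y} → x + c * y ≡ z + c * u + l → (u ≡ y + 1) ⊎ (u + 1 ≡ y) → c ≤ l →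
    z ≤ x × x ≤ z + (c + l)
  squeeze {x} {z} {c} {l} {u} {y} eq (inj₁ refl) _ = subst (z ≤_) (sym x≡) (m≤m+n z (c + l)) , ≤-reflexive x≡
    where
    x≡ : x ≡ z + (c + l)
    x≡ = +-cancelʳ-≡ (c * y) _ _ (trans eq (solve (z ∷ c ∷ y ∷ l ∷ [])))
  squeeze {x} {z} {c} {l} {u} {y} eq (inj₂ refl) c≤l =
    +-cancelʳ-≤ c z x (subst (z + c ≤_) (sym x+c≡) (+-monoʳ-≤ z c≤l)) ,
    ≤-trans (m≤m+n x c) (subst (_≤ z + (c + l)) (sym x+c≡) (+-monoʳ-≤ z (m≤n+m l c)))
    where
    x+c≡ : x + c ≡ z + l
    x+c≡ = +-cancelʳ-≡ (c * u) _ _ (begin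
      x + c + c * u     ≡⟨ solve (x ∷ c ∷ u ∷ []) ⟩
      x + c * (u + 1)   ≡⟨ eq ⟩
      z + c * u + l     ≡⟨ solve (z ∷ c ∷ u ∷ l ∷ []) ⟩
      z + l + c * u     ∎)
      where open ≡-Reasoning

  module _ {n a b : ℕ} (1≤n : 1 ≤ n) (n≤a : n ≤ a) where
    open ≤-Reasoning

    private
      v p excess : ℕ
      v = vPoly n a b
      p = pPoly n a b
      excess = 880 * (n * n) + remainder n a b

      n≤a² : n ≤ a * a
      n≤a² = ≤-trans n≤a (m≤m*n a a {{>-nonZero (≤-trans 1≤n n≤a)}})

    880n²≤remainder : 880 * (n * n) ≤ remainder n a b
    880n²≤remainder = begin
      880 * (n * n)        ≤⟨ *-mono-≤ (m≤m+n 880 3520) (*-monoʳ-≤ n n≤a²) ⟩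
      4400 * (n * (a * a)) ≤⟨ m≤m+n _ _ ⟩
      4400 * (n * (a * a)) + (n * (16720 * (a * b) + 2640 * (b * b))
        + (4400 * (a * a) + 30800 * (a * b) + 51920 * (b * b))) ≡⟨ solve (n ∷ a ∷ b ∷ []) ⟩
      n * (4400 * (a * a) + 16720 * (a * b) + 2640 * (b * b))
        + (4400 * (a * a) + 30800 * (a * b) + 51920 * (b * b)) ∎

    n*excess≤400v² : n * excess ≤ 400 * (v * v)
    n*excess≤400v² = begin
      n * (880 * (n * n) + (n * (4400 * (a * a) + 16720 * (a * b) + 2640 * (b * b))
                          + (4400 * (a * a) + 30800 * (a * b) + 51920 * (b * b))))
        ≡⟨ solve (n ∷ a ∷ b ∷ []) ⟩
      880 * (n * n) * n + (n * n) * (4400 * (a * a) + 16720 * (a * b) + 2640 * (b * b))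
        + n * (4400 * (a * a) + 30800 * (a * b) + 51920 * (b * b))
        ≤⟨ +-mono-≤ (+-monoˡ-≤ _ (*-monoʳ-≤ (880 * (n * n)) n≤a²)) (*-monoˡ-≤ _ n≤n²) ⟩
      880 * (n * n) * (a * a) + (n * n) * (4400 * (a * a) + 16720 * (a * b) + 2640 * (b * b))
        + (n * n) * (4400 * (a * a) + 30800 * (a * b) + 51920 * (b * b))
        ≤⟨ m≤m+n _ _ ⟩
      880 * (n * n) * (a * a) + (n * n) * (4400 * (a * a) + 16720 * (a * b) + 2640 * (b * b))
        + (n * n) * (4400 * (a * a) + 30800 * (a * b) + 51920 * (b * b))
        + (n * n) * (36688 * (a * a) + 60672 * (a * b) + 8552 * (b * b))
        ≡⟨ solve (n ∷ a ∷ b ∷ []) ⟩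
      322 * ((n * (12 * a + 14 * b)) * (n * (12 * a + 14 * b)))
        ≤⟨ *-monoʳ-≤ 322 (*-mono-≤ nγ≤v nγ≤v) ⟩
      322 * (v * v) ≤⟨ *-monoˡ-≤ (v * v) (m≤m+n 322 78) ⟩
      400 * (v * v) ∎
      where
      n≤n² : n ≤ n * n
      n≤n² = m≤m*n n n {{>-nonZero 1≤n}}
      nγ≤v : n * (12 * a + 14 * b) ≤ v
      nγ≤v = ≤-trans (m≤m+n _ (10 * a)) (m≤m+n _ (14 * b))

    module _ (cassini : Cassini a b) where

      private
        between : 5 * (v * v) ≤ p * p × p * p ≤ 5 * (v * v) + excess
        between = squeeze (pell-identity n a b) cassini 880n²≤remainder

      5vPoly²≤pPoly² : 5 * (v * v) ≤ p * p
      5vPoly²≤pPoly² = proj₁ between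

      pPoly²≤5vPoly²+ : ∀ f → 400 * f ≤ n → f * (p * p) ≤ 5 * f * (v * v) + v * v
      pPoly²≤5vPoly²+ f 400f≤n = begin
        f * (p * p)                 ≤⟨ *-monoʳ-≤ f (proj₂ between) ⟩
        f * (5 * (v * v) + excess)       ≡⟨ *-distribˡ-+ f _ excess ⟩
        f * (5 * (v * v)) + f * excess   ≡⟨ cong (_+ f * excess) (*-assoc f 5 (v * v)) ⟨
        f * 5 * (v * v) + f * excess     ≡⟨ cong (λ x → x * (v * v) + f * excess) (*-comm f 5) ⟩
        5 * f * (v * v) + f * excess     ≤⟨ +-monoʳ-≤ (5 * f * (v * v)) f*excess≤v² ⟩
        5 * f * (v * v) + v * v     ∎
        where
        f*excess≤v² : f * excess ≤ v * v
        f*excess≤v² = *-cancelˡ-≤ 400 (begin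
          400 * (f * excess) ≡⟨ *-assoc 400 f excess ⟨
          400 * f * excess   ≤⟨ *-monoˡ-≤ excess 400f≤n ⟩
          n * excess         ≤⟨ n*excess≤400v² ⟩
          400 * (v * v) ∎)

  vPoly-positive : ∀ n a b → 1 ≤ a → 1 ≤ vPoly n a b
  vPoly-positive n a b 1≤a = begin
    1                                         ≤⟨ 1≤a ⟩
    a                                         ≤⟨ m≤n*m a 10 ⟩
    10 * a                                    ≤⟨ m≤n+m (10 * a) (n * (12 * a + 14 * b)) ⟩
    n * (12 * a + 14 * b) + 10 * a            ≤⟨ m≤m+n _ (14 * b) ⟩
    n * (12 * a + 14 * b) + 10 * a + 14 * b   ∎
    where open ≤-Reasoning

  5v²≤p²⇒v≤p : ∀ {v p} → 5 * (v * v) ≤ p * p → v ≤ p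
  5v²≤p²⇒v≤p {v} {p} 5v²≤p² with v ≤? p
  ... | yes v≤p = v≤p
  ... | no  v≰p = contradiction 5v²≤p² (<⇒≱ (begin-strict
    p * p       <⟨ *-mono-< p<v p<v ⟩
    v * v       ≤⟨ m≤m+n (v * v) _ ⟩
    5 * (v * v) ∎))
    where
    p<v = ≰⇒> v≰p
    open ≤-Reasoning

  5V²≤P²⇒5V²<[P+g]² : ∀ {V P g} → 5 * (V * V) ≤ P * P → 0 < g → 5 * (V * V) < (P + g) * (P + g)
  5V²≤P²⇒5V²<[P+g]² {V} {P} {g} 5V²≤P² 0<g = begin-strict
    5 * (V * V)       ≤⟨ 5V²≤P² ⟩
    P * P             <⟨ *-mono-< P<P+g P<P+g ⟩
    (P + g) * (P + g) ∎
    where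
    P<P+g = m<m+n P 0<g
    open ≤-Reasoning

  u²<5V² : ∀ {u g P V h} → u + g ≡ P → P * P ≤ 5 * (V * V) + h → h < g * P → u * u < 5 * (V * V)
  u²<5V² {u} {g} {P} {V} {h} refl P²≤ h<gP = +-cancelʳ-< (g * P) (u * u) (5 * (V * V)) (begin-strict
    u * u + g * (u + g)           ≤⟨ m≤m+n _ (g * u) ⟩
    u * u + g * (u + g) + g * u   ≡⟨ solve (u ∷ g ∷ []) ⟩
    (u + g) * (u + g)             ≤⟨ P²≤ ⟩
    5 * (V * V) + h               <⟨ +-monoʳ-< (5 * (V * V)) h<gP ⟩
    5 * (V * V) + g * (u + g)     ∎)
    where open ≤-Reasoning

  module Bracket (v p f E : ℕ) (1≤v : 1 ≤ v) (1≤f : 1 ≤ f) (1≤E : 1 ≤ E)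
           (5v²≤p² : 5 * (v * v) ≤ p * p) (fp²≤ : f * (p * p) ≤ 5 * f * (v * v) + v * v) where
    open ≤-Reasoning

    private
      1≤g : 1 ≤ 22 * E * v
      1≤g = *-mono-≤ (*-mono-≤ (s≤s (z≤n {21})) 1≤E) 1≤v

    pf+g-positive : 0 < p * f + 22 * E * v
    pf+g-positive = ≤-trans 1≤g (m≤n+m _ (p * f))

    5[vf]²<[pf+g]² : 5 * ((v * f) * (v * f)) < (p * f + 22 * E * v) * (p * f + 22 * E * v)
    5[vf]²<[pf+g]² = 5V²≤P²⇒5V²<[P+g]² {v * f} {p * f} {22 * E * v} (begin
      5 * ((v * f) * (v * f)) ≡⟨ solve (v ∷ f ∷ []) ⟩
      5 * (v * v) * (f * f)   ≤⟨ *-monoˡ-≤ (f * f) 5v²≤p² ⟩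
      p * p * (f * f)         ≡⟨ solve (p ∷ f ∷ []) ⟩
      (p * f) * (p * f)       ∎) 1≤g

    [pf-g]²<5[vf]² : ∀ u → u + 22 * E * v ≡ p * f → u * u < 5 * ((v * f) * (v * f))
    [pf-g]²<5[vf]² u eq = u²<5V² {u} {22 * E * v} {p * f} {v * f} eq [pf]²≤ fv²<g*pf
      where
      [pf]²≤ : (p * f) * (p * f) ≤ 5 * ((v * f) * (v * f)) + f * (v * v)
      [pf]²≤ = begin
        (p * f) * (p * f)              ≡⟨ solve (p ∷ f ∷ []) ⟩
        f * (f * (p * p))              ≤⟨ *-monoʳ-≤ f fp²≤ ⟩
        f * (5 * f * (v * v) + v * v)  ≡⟨ solve (f ∷ v ∷ []) ⟩
        5 * ((v * f) * (v * f)) + f * (v * v) ∎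
      fv²<g*pf : f * (v * v) < 22 * E * v * (p * f)
      fv²<g*pf = begin-strict
        f * (v * v)                         <⟨ m<m+n (f * (v * v)) (*-mono-≤ (s≤s (z≤n {20})) 1≤fv²) ⟩
        f * (v * v) + 21 * (f * (v * v))    ≡⟨ solve (f ∷ v ∷ []) ⟩
        22 * (1 * ((v * v) * f))            ≤⟨ *-monoʳ-≤ 22 (*-mono-≤ 1≤E (*-monoˡ-≤ f (*-monoʳ-≤ v (5v²≤p²⇒v≤p 5v²≤p²)))) ⟩
        22 * (E * ((v * p) * f))            ≡⟨ solve (E ∷ v ∷ p ∷ f ∷ []) ⟩
        22 * E * v * (p * f)                ∎
        where
        1≤fv² : 1 ≤ f * (v * v)
        1≤fv² = *-mono-≤ 1≤f (*-mono-≤ 1≤v 1≤v)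

module RationalBounds where

  open import Data.Nat as ℕ using (ℕ; zero; suc)
  import Data.Nat.Properties as ℕ
  open import Data.Integer as ℤ using (+_; +[1+_]; -[1+_])
  import Data.Integer.Properties as ℤ
  open import Data.Rational
  open import Data.Rational.Properties
  import Data.Rational.Unnormalised as ℚᵘ
  import Data.Rational.Unnormalised.Properties as ℚᵘ
  open import Data.Rational.Solver using (module +-*-Solver)
  open +-*-Solver using (solve; _:=_; _:+_; _:*_; _:-_)
  open import Data.Product using (_,_; ∃)
  open import Data.Sum using (inj₁; inj₂)
  open import Relation.Binary.PropositionalEquality
  open import Relation.Nullary using (yes; no; contradiction)

  toℚᵘ-nat : ∀ a → toℚᵘ (nat a) ℚᵘ.≃ ℚᵘ.mkℚᵘ (+ a) 0
  toℚᵘ-nat a = toℚᵘ-fromℚᵘ (ℚᵘ.mkℚᵘ (+ a) 0)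

  nat-homo-+ : ∀ a b → nat (a ℕ.+ b) ≡ nat a + nat b
  nat-homo-+ a b = toℚᵘ-injective (ℚᵘ.≃-trans (toℚᵘ-nat (a ℕ.+ b)) (ℚᵘ.≃-trans sum≃
    (ℚᵘ.≃-sym (ℚᵘ.≃-trans (toℚᵘ-homo-+ (nat a) (nat b)) (ℚᵘ.+-cong (toℚᵘ-nat a) (toℚᵘ-nat b))))))
    where
    sum≃ : ℚᵘ.mkℚᵘ (+ (a ℕ.+ b)) 0 ℚᵘ.≃ ℚᵘ.mkℚᵘ (+ a) 0 ℚᵘ.+ ℚᵘ.mkℚᵘ (+ b) 0
    sum≃ = ℚᵘ.*≡* (trans (ℤ.*-identityʳ _) (trans (ℤ.pos-+ a b)
      (sym (trans (ℤ.*-identityʳ _) (cong₂ ℤ._+_ (ℤ.*-identityʳ (+ a)) (ℤ.*-identityʳ (+ b)))))))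

  nat-homo-* : ∀ a b → nat (a ℕ.* b) ≡ nat a * nat b
  nat-homo-* a b = toℚᵘ-injective (ℚᵘ.≃-trans (toℚᵘ-nat (a ℕ.* b)) (ℚᵘ.≃-trans product≃
    (ℚᵘ.≃-sym (ℚᵘ.≃-trans (toℚᵘ-homo-* (nat a) (nat b)) (ℚᵘ.*-cong (toℚᵘ-nat a) (toℚᵘ-nat b))))))
    where
    product≃ : ℚᵘ.mkℚᵘ (+ (a ℕ.* b)) 0 ℚᵘ.≃ ℚᵘ.mkℚᵘ (+ a) 0 ℚᵘ.* ℚᵘ.mkℚᵘ (+ b) 0
    product≃ = ℚᵘ.*≡* (cong (ℤ._* + 1) (ℤ.pos-* a b))

  nat-mono-< : ∀ {a b} → a ℕ.< b → nat a < nat b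
  nat-mono-< {a} {b} a<b = toℚᵘ-cancel-< (begin-strict
    toℚᵘ (nat a)          ≃⟨ toℚᵘ-nat a ⟩
    ℚᵘ.mkℚᵘ (+ a) 0       <⟨ ℚᵘ.*<* (subst₂ ℤ._<_ (sym (ℤ.*-identityʳ (+ a))) (sym (ℤ.*-identityʳ (+ b))) (ℤ.+<+ a<b)) ⟩
    ℚᵘ.mkℚᵘ (+ b) 0       ≃⟨ ℚᵘ.≃-sym (toℚᵘ-nat b) ⟩
    toℚᵘ (nat b)          ∎)
    where open ℚᵘ.≤-Reasoning

  *-denominator : ∀ q z d → toℚᵘ q ℚᵘ.≃ ℚᵘ.mkℚᵘ z d → q * nat (suc d) ≡ z / 1
  *-denominator q z d q≃ = toℚᵘ-injective (ℚᵘ.≃-trans (toℚᵘ-homo-* q (nat (suc d)))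
    (ℚᵘ.≃-trans (ℚᵘ.*-cong q≃ (toℚᵘ-nat (suc d))) (ℚᵘ.≃-trans cancel (ℚᵘ.≃-sym (toℚᵘ-fromℚᵘ (ℚᵘ.mkℚᵘ z 0))))))
    where
    cancel : ℚᵘ.mkℚᵘ z d ℚᵘ.* ℚᵘ.mkℚᵘ (+ suc d) 0 ℚᵘ.≃ ℚᵘ.mkℚᵘ z 0
    cancel = ℚᵘ.*≡* (trans (ℤ.*-identityʳ _) (cong (z ℤ.*_) (cong +_ (sym (ℕ.*-identityʳ (suc d))))))

  frac-*-denominator : ∀ a b → frac a (suc b) * nat (suc b) ≡ nat a
  frac-*-denominator a b = *-denominator (frac a (suc b)) (+ a) b (toℚᵘ-fromℚᵘ (ℚᵘ.mkℚᵘ (+ a) b))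

  positive-*-denominator : ∀ ε → 0ℚ < ε → ∃ λ E → ε * nat (suc (ℚ.denominator-1 ε)) ≡ nat (suc E)
  positive-*-denominator (mkℚ +[1+ e ] d c) _ = e , *-denominator (mkℚ +[1+ e ] d c) +[1+ e ] d ℚᵘ.≃-refl
  positive-*-denominator (mkℚ (+ zero) d c) (*<* (ℤ.+<+ ()))
  positive-*-denominator (mkℚ -[1+ e ] d c) (*<* ())

  module _ (k : ℕ) where

    private
      instance
        nat-k-nonNeg : NonNegative (nat k)
        nat-k-nonNeg = normalize-nonNeg k 1
        nat-k²-nonNeg : NonNegative (nat k * nat k)
        nat-k²-nonNeg = nonNeg*nonNeg⇒nonNeg (nat k) (nat k)

      square-scaled : ∀ x m → x * nat k ≡ nat m → (x * x) * (nat k * nat k) ≡ nat (m ℕ.* m)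
      square-scaled x m xk≡m = begin
        (x * x) * (nat k * nat k)     ≡⟨ solve 2 (λ x k → (x :* x) :* (k :* k) := (x :* k) :* (x :* k)) refl x (nat k) ⟩
        (x * nat k) * (x * nat k)     ≡⟨ cong₂ _*_ xk≡m xk≡m ⟩
        nat m * nat m                 ≡⟨ nat-homo-* m m ⟨
        nat (m ℕ.* m)                 ∎
        where open ≡-Reasoning

      5k² : nat (5 ℕ.* (k ℕ.* k)) ≡ nat 5 * (nat k * nat k)
      5k² = trans (nat-homo-* 5 (k ℕ.* k)) (cong (nat 5 *_) (nat-homo-* k k))

    sqrt5Lt-scaled : ∀ {x m} → x * nat k ≡ nat m → 0 ℕ.< m → 5 ℕ.* (k ℕ.* k) ℕ.< m ℕ.* m → sqrt5Lt x
    sqrt5Lt-scaled {x} {m} xk≡m 0<m 5k²<m² =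
      *-cancelʳ-<-nonNeg (nat k) (subst₂ _<_ (sym (*-zeroˡ (nat k))) (sym xk≡m) (nat-mono-< 0<m)) ,
      *-cancelʳ-<-nonNeg (nat k * nat k) (subst₂ _<_ 5k² (sym (square-scaled x m xk≡m)) (nat-mono-< 5k²<m²))

    ltSqrt5-scaled : ∀ {x m g} → x * nat k ≡ nat m - nat g →
      (∀ u → u ℕ.+ g ≡ m → u ℕ.* u ℕ.< 5 ℕ.* (k ℕ.* k)) → ltSqrt5 x
    ltSqrt5-scaled {x} {m} {g} xk≡m-g below with m ℕ.<? g
    ... | yes m<g = inj₁ (*-cancelʳ-<-nonNeg (nat k) (subst₂ _<_ (sym xk≡m-g) (sym (*-zeroˡ (nat k)))
                      (subst (nat m - nat g <_) (+-inverseʳ (nat g)) (+-monoˡ-< (- nat g) (nat-mono-< m<g)))))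
    ... | no  m≮g = inj₂ (*-cancelʳ-<-nonNeg (nat k * nat k)
                      (subst₂ _<_ (sym (square-scaled x u xk≡u)) 5k² (nat-mono-< (below u u+g≡m))))
      where
      u = m ℕ.∸ g
      u+g≡m : u ℕ.+ g ≡ m
      u+g≡m = ℕ.m∸n+n≡m (ℕ.≮⇒≥ m≮g)
      xk≡u : x * nat k ≡ nat u
      xk≡u = begin
        x * nat k             ≡⟨ xk≡m-g ⟩
        nat m - nat g         ≡⟨ cong (λ m → nat m - nat g) u+g≡m ⟨
        nat (u ℕ.+ g) - nat g ≡⟨ cong (_- nat g) (nat-homo-+ u g) ⟩
        nat u + nat g - nat g ≡⟨ solve 2 (λ u g → u :+ g :- g := u) refl (nat u) (nat g) ⟩
        nat u                 ∎
        where open ≡-Reasoning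

  module Rescaled (r ε : ℚ) (v d p f E : ℕ) (rv≡d : r * nat v ≡ nat d) (εf≡E : ε * nat f ≡ nat E)
           (p+22d≡7v : p ℕ.+ 22 ℕ.* d ≡ 7 ℕ.* v) where
    open ≡-Reasoning

    private
      7v≡p+22d : nat 7 * nat v ≡ nat p + nat 22 * nat d
      7v≡p+22d = begin
        nat 7 * nat v            ≡⟨ nat-homo-* 7 v ⟨
        nat (7 ℕ.* v)            ≡⟨ cong nat p+22d≡7v ⟨
        nat (p ℕ.+ 22 ℕ.* d)     ≡⟨ nat-homo-+ p (22 ℕ.* d) ⟩
        nat p + nat (22 ℕ.* d)   ≡⟨ cong (λ x → nat p + x) (nat-homo-* 22 d) ⟩
        nat p + nat 22 * nat d   ∎

      22Ev : nat (22 ℕ.* E ℕ.* v) ≡ nat 22 * nat E * nat v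
      22Ev = trans (nat-homo-* (22 ℕ.* E) v) (cong (_* nat v) (nat-homo-* 22 E))

      pf : nat (p ℕ.* f) ≡ nat p * nat f
      pf = nat-homo-* p f

    [7-22[r-ε]]*vf : (nat 7 - nat 22 * (r - ε)) * nat (v ℕ.* f) ≡ nat (p ℕ.* f ℕ.+ 22 ℕ.* E ℕ.* v)
    [7-22[r-ε]]*vf = begin
      (nat 7 - nat 22 * (r - ε)) * nat (v ℕ.* f)
        ≡⟨ cong ((nat 7 - nat 22 * (r - ε)) *_) (nat-homo-* v f) ⟩
      (nat 7 - nat 22 * (r - ε)) * (nat v * nat f)
        ≡⟨ solve 6 (λ s t r ε v f → (s :- t :* (r :- ε)) :* (v :* f)
                                 := (s :* v :- t :* (r :* v)) :* f :+ t :* (ε :* f) :* v)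
                 refl (nat 7) (nat 22) r ε (nat v) (nat f) ⟩
      (nat 7 * nat v - nat 22 * (r * nat v)) * nat f + nat 22 * (ε * nat f) * nat v
        ≡⟨ cong₂ (λ x y → (nat 7 * nat v - nat 22 * x) * nat f + nat 22 * y * nat v) rv≡d εf≡E ⟩
      (nat 7 * nat v - nat 22 * nat d) * nat f + nat 22 * nat E * nat v
        ≡⟨ cong (λ x → (x - nat 22 * nat d) * nat f + nat 22 * nat E * nat v) 7v≡p+22d ⟩
      (nat p + nat 22 * nat d - nat 22 * nat d) * nat f + nat 22 * nat E * nat v
        ≡⟨ solve 5 (λ p t d f g → (p :+ t :* d :- t :* d) :* f :+ g := p :* f :+ g)
                 refl (nat p) (nat 22) (nat d) (nat f) (nat 22 * nat E * nat v) ⟩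
      nat p * nat f + nat 22 * nat E * nat v
        ≡⟨ cong₂ _+_ pf 22Ev ⟨
      nat (p ℕ.* f) + nat (22 ℕ.* E ℕ.* v)
        ≡⟨ nat-homo-+ (p ℕ.* f) _ ⟨
      nat (p ℕ.* f ℕ.+ 22 ℕ.* E ℕ.* v) ∎

    [7-22[r+ε]]*vf : (nat 7 - nat 22 * (r + ε)) * nat (v ℕ.* f) ≡ nat (p ℕ.* f) - nat (22 ℕ.* E ℕ.* v)
    [7-22[r+ε]]*vf = begin
      (nat 7 - nat 22 * (r + ε)) * nat (v ℕ.* f)
        ≡⟨ cong ((nat 7 - nat 22 * (r + ε)) *_) (nat-homo-* v f) ⟩
      (nat 7 - nat 22 * (r + ε)) * (nat v * nat f)
        ≡⟨ solve 6 (λ s t r ε v f → (s :- t :* (r :+ ε)) :* (v :* f)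
                                 := (s :* v :- t :* (r :* v)) :* f :- t :* (ε :* f) :* v)
                 refl (nat 7) (nat 22) r ε (nat v) (nat f) ⟩
      (nat 7 * nat v - nat 22 * (r * nat v)) * nat f - nat 22 * (ε * nat f) * nat v
        ≡⟨ cong₂ (λ x y → (nat 7 * nat v - nat 22 * x) * nat f - nat 22 * y * nat v) rv≡d εf≡E ⟩
      (nat 7 * nat v - nat 22 * nat d) * nat f - nat 22 * nat E * nat v
        ≡⟨ cong (λ x → (x - nat 22 * nat d) * nat f - nat 22 * nat E * nat v) 7v≡p+22d ⟩
      (nat p + nat 22 * nat d - nat 22 * nat d) * nat f - nat 22 * nat E * nat v
        ≡⟨ solve 5 (λ p t d f g → (p :+ t :* d :- t :* d) :* f :- g := p :* f :- g)
                 refl (nat p) (nat 22) (nat d) (nat f) (nat 22 * nat E * nat v) ⟩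
      nat p * nat f - nat 22 * nat E * nat v
        ≡⟨ cong₂ _-_ pf 22Ev ⟨
      nat (p ℕ.* f) - nat (22 ℕ.* E ℕ.* v) ∎

  frac-*-scaled : ∀ a b c → 0 ℕ.< c ℕ.* b → frac a b * nat (c ℕ.* b) ≡ nat (c ℕ.* a)
  frac-*-scaled a zero    c 0<c*0 = contradiction (subst (0 ℕ.<_) (ℕ.*-zeroʳ c) 0<c*0) λ ()
  frac-*-scaled a (suc b) c _     = begin
    frac a (suc b) * nat (c ℕ.* suc b)          ≡⟨ cong (frac a (suc b) *_) (nat-homo-* c (suc b)) ⟩
    frac a (suc b) * (nat c * nat (suc b))      ≡⟨ solve 3 (λ r c b → r :* (c :* b) := c :* (r :* b)) refl (frac a (suc b)) (nat c) (nat (suc b)) ⟩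
    nat c * (frac a (suc b) * nat (suc b))      ≡⟨ cong (nat c *_) (frac-*-denominator a b) ⟩
    nat c * nat a                               ≡⟨ nat-homo-* c a ⟨
    nat (c ℕ.* a)                               ∎
    where open ≡-Reasoning

open import Data.Bool using (false; true)
open import Data.Nat as ℕ using (suc; z≤n; s≤s)
import Data.Nat.Properties as ℕ
open import Data.Rational using (ℚ; _-_; _+_; _*_)
open import Data.Product using (_×_; _,_; proj₁; proj₂)
open import Relation.Binary.PropositionalEquality
open FirstLetterSums using (startCount)
open ClosedForms
open Estimates
open RationalBounds

theorem3p11 : ConvergesToL (λ n → frac (D4 n) (V n))
theorem3p11 ε 0<ε = 400 ℕ.* f , converges
  where
  f = suc (ℚ.denominator-1 ε)
  E = suc (proj₁ (positive-*-denominator ε 0<ε))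
  converges : ∀ n → 400 ℕ.* f ℕ.≤ n → ltL (frac (D4 n) (V n) - ε) × Lgt (frac (D4 n) (V n) + ε)
  converges (suc m) 400f≤n =
    sqrt5Lt-scaled (v ℕ.* f) [7-22[r-ε]]*vf pf+g-positive 5[vf]²<[pf+g]² ,
    ltSqrt5-scaled (v ℕ.* f) [7-22[r+ε]]*vf [pf-g]²<5[vf]²
    where
    n = suc m
    a = startCount false m
    b = startCount true m
    v = vPoly n a b
    open FibonacciPair (startCounts-fibonacci m)
    0<v = vPoly-positive n a b (ℕ.≤-trans (s≤s z≤n) n≤a)
    r*v≡5D = subst (λ x → frac (D4 n) (V n) * nat x ≡ nat (5 ℕ.* D4 n)) (5*V-closedForm m)
                   (frac-*-scaled (D4 n) (V n) 5 (subst (0 ℕ.<_) (sym (5*V-closedForm m)) 0<v))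
    open Bracket v (pPoly n a b) f E 0<v (s≤s z≤n) (s≤s z≤n)
                 (5vPoly²≤pPoly² (s≤s z≤n) n≤a cassini) (pPoly²≤5vPoly²+ (s≤s z≤n) n≤a cassini f 400f≤n)
    open Rescaled (frac (D4 n) (V n)) ε v (5 ℕ.* D4 n) (pPoly n a b) f E r*v≡5D
                  (proj₂ (positive-*-denominator ε 0<ε)) (pPoly+22*d n a b (5 ℕ.* D4 n) (5*D4-closedForm m))
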